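{- Let $r\ge 2$ and let $Q\subseteq P(r)$ be a nonempty set of partitions of $r$ such that neither $M=(r)$ nor $R=(1,1,\ldots,1)$ belongs to $Q$. Then the $\Sigma$-hypergraph $H=H(2r,\,r,\,(r-1)^2+1\mid \Sigma=Q)$ (which has $2r((r-1)^2+1)$ vertices) is tightly $Q$-colourable; that is: (1) there is a single integer $k$ such that $H$ has a $k$-$Q$-colouring and has no $j$-$Q$-colouring for any $j\neq k$; (2) the $k$-$Q$-colouring of $H$ is unique up to renaming the colours (any two $k$-$Q$-colourings induce the same partition of $V(H)$ into colour classes); (3) the colour classes of this colouring all have the same size; (4) for every $\pi\in Q$, $H$ has no $(Q\setminus\{\pi\})$-colouring (with any number of colours).
   Context: $P(r)$ denotes the set of all partitions of the integer $r$; $M=(r)$ is the monochromatic partition and $R=(1,1,\ldots,1)$ the rainbow partition. For $\Sigma\subseteq P(r)$ and positive integers $n,q$, the $\Sigma$-hypergraph $H(n,r,q\mid\Sigma)$ is the $r$-uniform hypergraph whose vertex set is partitioned into $n$ classes $V_1,\ldots,V_n$ of $q$ vertices each, in which an $r$-subset $K$ of vertices is an edge iff the partition of $r$ formed by the nonzero numbers $|K\cap V_i|$, $1\le i\le n$, belongs to $\Sigma$. Given a vertex colouring of an $r$-uniform hypergraph, the pattern $pat(E)$ of an edge $E$ is the partition of $r$ formed by the numbers of vertices of $E$ of each colour appearing in $E$. For $Q\subseteq P(r)$, a $Q$-colouring is a vertex colouring in which $pat(E)\in Q$ for every edge $E$; a $k$-$Q$-colouring is a $Q$-colouring using exactly $k$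 colours (each of the $k$ colours is used on at least one vertex). -}

module Defs where

open import Data.Nat using (ℕ; zero; suc; _+_; _*_; _∸_; _^_; _≤_; _<_; _≥_; _≤?_)
open import Data.Nat.Properties using ()
open import Data.Fin using (Fin) renaming (_≟_ to _≟ᶠ_)
open import Data.List using (List; []; _∷_; length; map; filter; allFin; cartesianProduct; replicate)
open import Data.Nat.ListAction using (sum)
open import Data.List.Relation.Unary.All using (All)
open import Data.List.Relation.Unary.Linked using (Linked)
open import Data.List.Relation.Unary.Unique.Propositional using (Unique)
open import Data.List.Relation.Binary.Permutation.Propositional using (_↭_)
open import Data.Product using (Σ; ∃; ∃-syntax; _×_; _,_)
open import Relation.Binary.PropositionalEquality using (_≡_; _≢_)
open import Function.Definitions using (Surjective)
open import Function.Bundles using (_⇔_)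

IsPartition : ℕ → List ℕ → Set
IsPartition r p = All (λ x → 1 ≤ x) p × Linked _≥_ p × sum p ≡ r

PSet : Set₁
PSet = List ℕ → Set

Mono : ℕ → List ℕ
Mono r = r ∷ []

Rainbow : ℕ → List ℕ
Rainbow r = replicate r 1

_∖[_] : PSet → List ℕ → PSet
(Q ∖[ π ]) p = Q p × p ≢ π

-- The multiset of nonzero block sizes of the list K w.r.t. the labelling f
-- (for f = class map: the |K ∩ V_i|; for f = colouring: the pattern).
profile : {A : Set} {m : ℕ} → (A → Fin m) → List A → List ℕ
profile {m = m} f K =
  filter (λ x → 1 ≤? x)
         (map (λ j → length (filter (λ a → f a ≟ᶠ j) K)) (allFin m))

InP : PSet → List ℕ → Set
InP Q xs = ∃[ π ] (Q π × xs ↭ π)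

-- Vertices of H(n, r, q | Σ): class i ∈ Fin n, index within the class ∈ Fin q.
Vtx : ℕ → ℕ → Set
Vtx n q = Fin n × Fin q

allVtx : (n q : ℕ) → List (Vtx n q)
allVtx n q = cartesianProduct (allFin n) (allFin q)

cls : {n q : ℕ} → Vtx n q → Fin n
cls (i , _) = i

IsEdge : (n r q : ℕ) → PSet → List (Vtx n q) → Set
IsEdge n r q Σ' K = Unique K × length K ≡ r × InP Σ' (profile cls K)

IsQCol : (n r q : ℕ) → PSet → PSet → {k : ℕ} → (Vtx n q → Fin k) → Set
IsQCol n r q Σ' Q c = ∀ K → IsEdge n r q Σ' K → InP Q (profile c K)

IsKQCol : (n r q : ℕ) → PSet → PSet → (k : ℕ) → (Vtx n q → Fin k) → Set
IsKQCol n r q Σ' Q k c = IsQCol n r q Σ' Q c × Surjective _≡_ _≡_ c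

classSize : {n q k : ℕ} → (Vtx n q → Fin k) → Fin k → ℕ
classSize {n} {q} c a = length (filter (λ v → c v ≟ᶠ a) (allVtx n q))

module Submission where

-- Every Q-colouring of H is the partition into classes. By pigeonhole, each class of
-- (r − 1)² + 1 vertices contains r vertices that are monochromatic ("heavy" class) or
-- rainbow. Let T and t be the largest and smallest numbers of parts of a partition in Q;
-- T < r as R ∉ Q, and t ≥ 2 as M ∉ Q. At most T − 1 classes are rainbow, for otherwise
-- blocks chosen greedily from T of them form an edge of the longest shape with r colours;
-- so at least r + 2 classes are heavy. Two heavy classes never share their colour: blocks
-- of a shortest shape on them and t − 2 further heavy classes would show only t − 1
-- colours. Finally, a class carrying two colours (a rainbow class, or a heavy class with a
-- stray vertex) starts a block of the longest shape which, completed by heavy classes of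
-- fresh colours, shows T + 1 colours. The extremal lengths exist only classically, but the
-- conclusions are decidable equalities, so double negation suffices.

open import Defs
open import Data.Nat using (ℕ; suc; _+_; _*_; _∸_; _^_; _≤_)
open import Data.Fin using (Fin)
open import Data.List using (List)
open import Data.Product using (Σ; ∃; ∃-syntax; _×_; _,_)
open import Relation.Nullary using (¬_)
open import Relation.Binary.PropositionalEquality using (_≡_)
open import Function.Bundles using (_⇔_)

open import Data.Bool using (true; false)
open import Data.Empty using (⊥; ⊥-elim)
open import Data.Fin using (zero; suc; _≟_; fromℕ<)
open import Data.Fin.Properties using (cantor-schröder-bernstein) renaming (suc-injective to Fin-suc-injective)
open import Data.List using ([]; _∷_; length; map; filter; allFin; _++_; take; tabulate; replicate; cartesianProduct)
open import Data.List.Properties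
  using ( length-++; length-map; length-tabulate; length-take; map-++; map-∘; map-tabulate; ++-assoc; ++-identityʳ
        ; take-map; tabulate-cong; filter-accept; filter-reject; filter-++; filter-all; filter-none; filter-≐ )
open import Data.List.Membership.Propositional using (_∈_)
open import Data.List.Membership.Propositional.Properties
  using (∈-∃++; ∈-++⁻; ∈-++⁺ʳ; ∈-map⁺; ∈-map⁻; ∈-filter⁺; ∈-filter⁻; ∈-allFin)
open import Data.List.Relation.Binary.Permutation.Propositional
  using (_↭_; ↭-refl; ↭-reflexive; ↭-sym; ↭-trans; ↭-prep; ↭-swap; ↭⇒↭ₛ; module PermutationReasoning)
open import Data.List.Relation.Binary.Permutation.Propositional.Properties using (↭-length)
open import Data.List.Relation.Binary.Pointwise using (Pointwise-≡⇒≡)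
import Data.List.Relation.Binary.Sublist.Propositional.Properties as Sublist
open import Data.List.Relation.Binary.Subset.Propositional using (_⊆_)
import Data.List.Relation.Binary.Subset.Propositional.Properties as Subset
open import Data.List.Relation.Unary.All as All using (All; []; _∷_)
open import Data.List.Relation.Unary.All.Properties using (¬Any⇒All¬)
open import Data.List.Relation.Unary.AllPairs using ([]; _∷_)
open import Data.List.Relation.Unary.Any as Any using (here; there; any?)
open import Data.List.Relation.Unary.Linked.Properties using (Linked⇒All)
import Data.List.Relation.Unary.Sorted.TotalOrder.Properties as Sorted
open import Data.List.Relation.Unary.Unique.Propositional using (Unique)
import Data.List.Relation.Unary.Unique.Propositional.Properties as Unique
open import Data.Nat using (zero; _<_; _≤?_; z≤n; s≤s)
open import Data.Nat.Induction using (<-rec)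
open import Data.Nat.ListAction using (sum)
open import Data.Nat.Properties hiding (_≟_)
open import Data.Product as Product using (proj₁; proj₂; ∃₂)
open import Data.Sum as Sum using (_⊎_; inj₁; inj₂; [_,_]′)
open import Function using (_∘_)
open import Function.Bundles using (Equivalence; mk⇔)
open import Function.Definitions using (Surjective)
import Function.Properties.Equivalence as ⇔
open import Induction.WellFounded using (WfRec)
open import Relation.Binary.PropositionalEquality using (_≢_; refl; sym; trans; cong; cong₂; subst; module ≡-Reasoning)
import Relation.Binary.Construct.Flip.EqAndOrd as Flip
open import Relation.Nullary using (Dec; yes; no; does; ¬?)
open import Relation.Nullary.Decidable using (_⊎-dec_; decidable-stable)
open import Relation.Unary using (Pred; Decidable)

private variable
  A B : Set
  m n q : ℕ

∈-take : ∀ n {xs : List A} {z} → z ∈ take n xs → z ∈ xs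
∈-take (suc n) {x ∷ xs} (here p) = here p
∈-take (suc n) {x ∷ xs} (there p) = there (∈-take n p)

length-take-≤ : ∀ n (xs : List A) → n ≤ length xs → length (take n xs) ≡ n
length-take-≤ n xs n≤ = trans (length-take n xs) (m≤n⇒m⊓n≡m n≤)

length-filter-∁ : ∀ {ℓ} {P : Pred A ℓ} (P? : Decidable P) (xs : List A) →
  length (filter P? xs) + length (filter (¬? ∘ P?) xs) ≡ length xs
length-filter-∁ P? [] = refl
length-filter-∁ P? (x ∷ xs) with P? x
... | yes _ = cong suc (length-filter-∁ P? xs)
... | no _ = trans (+-suc _ _) (cong suc (length-filter-∁ P? xs))

length-filter-∘ : ∀ {ℓ} {P : Pred B ℓ} (P? : Decidable P) (g : A → B) (xs : List A) →
  length (filter P? (map g xs)) ≡ length (filter (P? ∘ g) xs)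
length-filter-∘ P? g [] = refl
length-filter-∘ P? g (x ∷ xs) with does (P? (g x))
... | false = length-filter-∘ P? g xs
... | true = cong suc (length-filter-∘ P? g xs)

∈-delete : ∀ (as : List A) {x bs z} → z ≢ x → z ∈ as ++ x ∷ bs → z ∈ as ++ bs
∈-delete [] z≢x (here z≡x) = ⊥-elim (z≢x z≡x)
∈-delete [] z≢x (there z∈) = z∈
∈-delete (a ∷ as) z≢x (here z≡a) = here z≡a
∈-delete (a ∷ as) z≢x (there z∈) = there (∈-delete as z≢x z∈)

Unique⇒length≤ : ∀ {xs ys : List A} → Unique xs → xs ⊆ ys → length xs ≤ length ys
Unique⇒length≤ {xs = []} _ _ = z≤n
Unique⇒length≤ {xs = x ∷ xs} (x∉xs ∷ xs!) x∷xs⊆ys with as , bs , refl ← ∈-∃++ (x∷xs⊆ys (here refl)) = begin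
  suc (length xs)             ≤⟨ s≤s (Unique⇒length≤ xs! xs⊆as++bs) ⟩
  suc (length (as ++ bs))     ≡⟨ cong suc (length-++ as) ⟩
  suc (length as + length bs) ≡⟨ +-suc (length as) (length bs) ⟨
  length as + suc (length bs) ≡⟨ length-++ as ⟨
  length (as ++ x ∷ bs)       ∎
  where
  open ≤-Reasoning
  xs⊆as++bs : xs ⊆ as ++ bs
  xs⊆as++bs z∈xs = ∈-delete as (λ z≡x → All.lookup x∉xs z∈xs (sym z≡x)) (x∷xs⊆ys (there z∈xs))

Unique-map-take : ∀ (g : A → B) n {xs} → Unique (map g xs) → Unique (map g (take n xs))
Unique-map-take g n {xs} gxs! = subst Unique (take-map n xs) (Unique.take⁺ n gxs!)

Unique-map-filter : ∀ (g : A → B) {ℓ} {P : Pred A ℓ} (P? : Decidable P) {xs} →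
  Unique (map g xs) → Unique (map g (filter P? xs))
Unique-map-filter g P? {[]} _ = []
Unique-map-filter g P? {x ∷ xs} (gx∉ ∷ gxs!) with does (P? x)
... | false = Unique-map-filter g P? gxs!
... | true = All.tabulate gx∉filter ∷ Unique-map-filter g P? gxs!
  where
  gx∉filter : ∀ {z} → z ∈ map g (filter P? xs) → g x ≢ z
  gx∉filter z∈ with y , y∈ , refl ← ∈-map⁻ g z∈ = All.lookup gx∉ (∈-map⁺ g (proj₁ (∈-filter⁻ P? y∈)))

Unique-map-injectiveOn : ∀ (g : A → B) {xs} → Unique xs →
  (∀ {x y} → x ∈ xs → y ∈ xs → g x ≡ g y → x ≡ y) → Unique (map g xs)
Unique-map-injectiveOn g [] _ = []
Unique-map-injectiveOn g (x∉ ∷ xs!) inj =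
  All.tabulate (λ z∈ gx≡z → let y , y∈ , z≡gy = ∈-map⁻ g z∈ in
                            All.lookup x∉ y∈ (inj (here refl) (there y∈) (trans gx≡z z≡gy)))
  ∷ Unique-map-injectiveOn g xs! (λ x∈ y∈ → inj (there x∈) (there y∈))

module _ {ℓ} {P : Pred A ℓ} (P? : Decidable P) where

  avoiding : ℕ → List A → List A
  avoiding k xs = take k (filter (¬? ∘ P?) xs)

  length-avoiding : ∀ k b xs → length (filter P? xs) ≤ b → k + b ≤ length xs → length (avoiding k xs) ≡ k
  length-avoiding k b xs few-P k+b≤ = length-take-≤ k _ (+-cancelʳ-≤ b k _ (begin
    k + b                                             ≤⟨ k+b≤ ⟩
    length xs                                         ≡⟨ length-filter-∁ P? xs ⟨
    length (filter P? xs) + length (filter (¬? ∘ P?) xs) ≤⟨ +-monoˡ-≤ _ few-P ⟩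
    b + length (filter (¬? ∘ P?) xs)                  ≡⟨ +-comm b _ ⟩
    length (filter (¬? ∘ P?) xs) + b                  ∎))
    where open ≤-Reasoning

  ∈-avoiding⁻ : ∀ k xs {y} → y ∈ avoiding k xs → y ∈ xs × ¬ P y
  ∈-avoiding⁻ k xs y∈ = ∈-filter⁻ (¬? ∘ P?) {xs = xs} (∈-take k y∈)

  Unique-avoiding : ∀ k {xs} → Unique xs → Unique (avoiding k xs)
  Unique-avoiding k xs! = Unique.take⁺ k (Unique.filter⁺ (¬? ∘ P?) xs!)

-- Patterns

count : (A → Fin m) → List A → Fin m → ℕ
count f K j = length (filter (λ a → f a ≟ j) K)

positives : List ℕ → List ℕ
positives = filter (1 ≤?_)

positives-insert : ∀ {m} (w w′ : Fin m → ℕ) (i : Fin m) → w i ≡ 0 → 1 ≤ w′ i →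
  (∀ j → j ≢ i → w′ j ≡ w j) → positives (tabulate w′) ↭ w′ i ∷ positives (tabulate w)
positives-insert w w′ zero wi≡0 1≤w′i same = ↭-reflexive (begin
  positives (tabulate w′)                    ≡⟨ filter-accept (1 ≤?_) 1≤w′i ⟩
  w′ zero ∷ positives (tabulate (w′ ∘ suc))  ≡⟨ cong (λ ws → w′ zero ∷ positives ws) (tabulate-cong λ j → same (suc j) λ ()) ⟩
  w′ zero ∷ positives (tabulate (w ∘ suc))   ≡⟨ cong (λ x → w′ zero ∷ positives (x ∷ tabulate (w ∘ suc))) wi≡0 ⟨
  w′ zero ∷ positives (tabulate w)           ∎)
  where open ≡-Reasoning
positives-insert w w′ (suc i) wi≡0 1≤w′i same = split (1 ≤? w zero)
  where
  open PermutationReasoning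
  w′0≡w0 : w′ zero ≡ w zero
  w′0≡w0 = same zero λ ()
  tail↭ : positives (tabulate (w′ ∘ suc)) ↭ w′ (suc i) ∷ positives (tabulate (w ∘ suc))
  tail↭ = positives-insert (w ∘ suc) (w′ ∘ suc) i wi≡0 1≤w′i (λ j j≢i → same (suc j) (j≢i ∘ Fin-suc-injective))
  split : Dec (1 ≤ w zero) → positives (tabulate w′) ↭ w′ (suc i) ∷ positives (tabulate w)
  split (yes 1≤w0) = begin
    positives (tabulate w′)                                ≡⟨ filter-accept (1 ≤?_) (subst (1 ≤_) (sym w′0≡w0) 1≤w0) ⟩
    w′ zero ∷ positives (tabulate (w′ ∘ suc))              ≡⟨ cong (_∷ _) w′0≡w0 ⟩
    w zero ∷ positives (tabulate (w′ ∘ suc))               ↭⟨ ↭-prep (w zero) tail↭ ⟩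
    w zero ∷ w′ (suc i) ∷ positives (tabulate (w ∘ suc))   ↭⟨ ↭-swap (w zero) (w′ (suc i)) ↭-refl ⟩
    w′ (suc i) ∷ w zero ∷ positives (tabulate (w ∘ suc))   ≡⟨ cong (w′ (suc i) ∷_) (filter-accept (1 ≤?_) 1≤w0) ⟨
    w′ (suc i) ∷ positives (tabulate w)                    ∎
  split (no 1≰w0) = begin
    positives (tabulate w′)                       ≡⟨ filter-reject (1 ≤?_) (1≰w0 ∘ subst (1 ≤_) w′0≡w0) ⟩
    positives (tabulate (w′ ∘ suc))               ↭⟨ tail↭ ⟩
    w′ (suc i) ∷ positives (tabulate (w ∘ suc))   ≡⟨ cong (w′ (suc i) ∷_) (filter-reject (1 ≤?_) 1≰w0) ⟨
    w′ (suc i) ∷ positives (tabulate w)           ∎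

profile≡positives : (f : A → Fin m) (K : List A) → profile f K ≡ positives (tabulate (count f K))
profile≡positives f K = cong positives (map-tabulate (λ j → j) (count f K))

positives-zeros : ∀ m → positives (tabulate {n = m} (λ _ → 0)) ≡ []
positives-zeros zero = refl
positives-zeros (suc m) = positives-zeros m

profile-[] : (f : A → Fin m) → profile f [] ≡ []
profile-[] {m = m} f = trans (profile≡positives f []) (positives-zeros m)

count-++ : (f : A → Fin m) (B K : List A) (j : Fin m) → count f (B ++ K) j ≡ count f B j + count f K j
count-++ f B K j = trans (cong length (filter-++ (λ a → f a ≟ j) B K)) (length-++ (filter (λ a → f a ≟ j) B))

profile-block-++ : (f : A → Fin m) {i : Fin m} (B K : List A) → All (λ a → f a ≡ i) B → All (λ a → f a ≢ i) K →
  1 ≤ length B → profile f (B ++ K) ↭ length B ∷ profile f K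
profile-block-++ f {i} B K B≡i K≢i 1≤|B| = begin
  profile f (B ++ K)                                     ≡⟨ profile≡positives f (B ++ K) ⟩
  positives (tabulate (count f (B ++ K)))                ↭⟨ positives-insert (count f K) (count f (B ++ K)) i countKi≡0
                                                              (subst (1 ≤_) (sym countBKi≡|B|) 1≤|B|) countBKj≡countKj ⟩
  count f (B ++ K) i ∷ positives (tabulate (count f K))  ≡⟨ cong₂ _∷_ countBKi≡|B| (sym (profile≡positives f K)) ⟩
  length B ∷ profile f K                                 ∎
  where
  open PermutationReasoning
  countKi≡0 : count f K i ≡ 0
  countKi≡0 = cong length (filter-none (λ a → f a ≟ i) K≢i)
  countBKi≡|B| : count f (B ++ K) i ≡ length B
  countBKi≡|B| = trans (count-++ f B K i)
    (trans (cong₂ _+_ (cong length (filter-all (λ a → f a ≟ i) B≡i)) countKi≡0) (+-identityʳ (length B)))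
  countBKj≡countKj : ∀ j → j ≢ i → count f (B ++ K) j ≡ count f K j
  countBKj≡countKj j j≢i = trans (count-++ f B K j)
    (cong (_+ count f K j) (cong length (filter-none (λ a → f a ≟ j) (All.map (λ fa≡i fa≡j → j≢i (trans (sym fa≡j) fa≡i)) B≡i))))

colours : (A → Fin m) → List A → List (Fin m)
colours f K = filter (λ j → 1 ≤? count f K j) (allFin _)

length-profile : (f : A → Fin m) (K : List A) → length (profile f K) ≡ length (colours f K)
length-profile f K = length-filter-∘ (1 ≤?_) (count f K) (allFin _)

count-pos⇒∈ : (f : A → Fin m) (K : List A) {j : Fin m} → 1 ≤ count f K j → j ∈ map f K
count-pos⇒∈ f (a ∷ K) {j} 1≤ with f a ≟ j
... | yes fa≡j = here (sym fa≡j)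
... | no _ = there (count-pos⇒∈ f K 1≤)

∈⇒count-pos : (f : A → Fin m) (K : List A) {j : Fin m} → j ∈ map f K → 1 ≤ count f K j
∈⇒count-pos f (a ∷ K) {j} j∈ with f a ≟ j | j∈
... | yes _ | _ = s≤s z≤n
... | no fa≢j | here j≡fa = ⊥-elim (fa≢j (sym j≡fa))
... | no _ | there j∈′ = ∈⇒count-pos f K j∈′

≤-length-profile : (f : A → Fin m) (K : List A) {zs : List (Fin m)} → Unique zs → zs ⊆ map f K →
  length zs ≤ length (profile f K)
≤-length-profile f K zs! zs⊆ = subst (_ ≤_) (sym (length-profile f K))
  (Unique⇒length≤ zs! λ {z} z∈ → ∈-filter⁺ (λ j → 1 ≤? count f K j) (∈-allFin z) (∈⇒count-pos f K (zs⊆ z∈)))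

length-profile-≤ : (f : A → Fin m) (K : List A) {S : List (Fin m)} → map f K ⊆ S → length (profile f K) ≤ length S
length-profile-≤ f K K⊆S = subst (_≤ _) (sym (length-profile f K))
  (Unique⇒length≤ (Unique.filter⁺ (λ j → 1 ≤? count f K j) (Unique.allFin⁺ _))
    λ z∈ → K⊆S (count-pos⇒∈ f K (proj₂ (∈-filter⁻ (λ j → 1 ≤? count f K j) {xs = allFin _} z∈))))

-- Edges assembled from blocks

Block : ℕ → ℕ → Set
Block n q = Fin n × List (Fin q)

blockVertices : Block n q → List (Vtx n q)
blockVertices (i , ls) = map (i ,_) ls

edgeOf : List (Block n q) → List (Vtx n q)
edgeOf [] = []
edgeOf (b ∷ bs) = blockVertices b ++ edgeOf bs

partsOf : List (Block n q) → List ℕ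
partsOf = map (length ∘ proj₂)

classesOf : List (Block n q) → List (Fin n)
classesOf = map proj₁

cls-∈-classesOf : (bs : List (Block n q)) {v : Vtx n q} → v ∈ edgeOf bs → cls v ∈ classesOf bs
cls-∈-classesOf ((i , ls) ∷ bs) v∈ with ∈-++⁻ (blockVertices (i , ls)) v∈
... | inj₁ v∈b with _ , _ , refl ← ∈-map⁻ (i ,_) v∈b = here refl
... | inj₂ v∈bs = there (cls-∈-classesOf bs v∈bs)

Unique-edgeOf : (bs : List (Block n q)) → Unique (classesOf bs) → All (Unique ∘ proj₂) bs → Unique (edgeOf bs)
Unique-edgeOf [] _ _ = []
Unique-edgeOf ((i , ls) ∷ bs) (i∉ ∷ classes!) (ls! ∷ lss!) =
  Unique.++⁺ (Unique.map⁺ (cong proj₂) ls!) (Unique-edgeOf bs classes! lss!) disjoint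
  where
  disjoint : ∀ {v} → ¬ (v ∈ blockVertices (i , ls) × v ∈ edgeOf bs)
  disjoint (v∈b , v∈bs) with _ , _ , refl ← ∈-map⁻ (i ,_) v∈b = All.lookup i∉ (cls-∈-classesOf bs v∈bs) refl

length-edgeOf : (bs : List (Block n q)) → length (edgeOf bs) ≡ sum (partsOf bs)
length-edgeOf [] = refl
length-edgeOf ((i , ls) ∷ bs) = trans (length-++ (map (i ,_) ls)) (cong₂ _+_ (length-map _ ls) (length-edgeOf bs))

profile-edgeOf : (f : Vtx n q → Fin m) (a : Fin n → Fin m) → (∀ {i j} → a i ≡ a j → i ≡ j) →
  (∀ v → f v ≡ a (cls v)) → (bs : List (Block n q)) → Unique (classesOf bs) → All (1 ≤_) (partsOf bs) →
  profile f (edgeOf bs) ↭ partsOf bs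
profile-edgeOf f a a-inj f≡a∘cls [] _ _ = ↭-reflexive (profile-[] f)
profile-edgeOf f a a-inj f≡a∘cls ((i , ls) ∷ bs) (i∉ ∷ classes!) (1≤|ls| ∷ 1≤parts) = begin
  profile f (blockVertices (i , ls) ++ edgeOf bs)      ↭⟨ profile-block-++ f (blockVertices (i , ls)) (edgeOf bs) block≡ai rest≢ai
                                                            (subst (1 ≤_) (sym (length-map _ ls)) 1≤|ls|) ⟩
  length (blockVertices (i , ls)) ∷ profile f (edgeOf bs) ≡⟨ cong (_∷ _) (length-map _ ls) ⟩
  length ls ∷ profile f (edgeOf bs)                    ↭⟨ ↭-prep (length ls) (profile-edgeOf f a a-inj f≡a∘cls bs classes! 1≤parts) ⟩
  length ls ∷ partsOf bs                               ∎
  where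
  open PermutationReasoning
  block≡ai : All (λ v → f v ≡ a i) (blockVertices (i , ls))
  block≡ai = All.tabulate λ v∈ → let l , _ , v≡il = ∈-map⁻ (i ,_) v∈ in subst (λ v → f v ≡ a i) (sym v≡il) (f≡a∘cls (i , l))
  rest≢ai : All (λ v → f v ≢ a i) (edgeOf bs)
  rest≢ai = All.tabulate λ {v} v∈ fv≡ai → All.lookup i∉ (cls-∈-classesOf bs v∈) (sym (a-inj (trans (sym (f≡a∘cls v)) fv≡ai)))

edgeOf-isEdge : ∀ {r} {Q : PSet} {π} (bs : List (Block n q)) → IsPartition r π → Q π → partsOf bs ≡ π →
  Unique (classesOf bs) → All (Unique ∘ proj₂) bs → IsEdge n r q Q (edgeOf bs)
edgeOf-isEdge bs (1≤π , _ , sumπ≡r) Qπ parts≡π classes! blocks! =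
  Unique-edgeOf bs classes! blocks! ,
  trans (length-edgeOf bs) (trans (cong sum parts≡π) sumπ≡r) ,
  (_ , Qπ , subst (profile cls (edgeOf bs) ↭_) parts≡π
             (profile-edgeOf cls (λ i → i) (λ i≡j → i≡j) (λ _ → refl) bs classes! (subst (All (1 ≤_)) (sym parts≡π) 1≤π)))

fill : List ℕ → List (Fin n) → (Fin n → List (Fin q)) → List (Block n q)
fill (p ∷ ps) (i ∷ cs) src = (i , take p (src i)) ∷ fill ps cs src
fill _ _ _ = []

classesOf-fill : ∀ ps (cs : List (Fin n)) (src : Fin n → List (Fin q)) → length cs ≡ length ps →
  classesOf (fill ps cs src) ≡ cs
classesOf-fill [] [] src _ = refl
classesOf-fill (p ∷ ps) (i ∷ cs) src |cs|≡ = cong (i ∷_) (classesOf-fill ps cs src (suc-injective |cs|≡))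

partsOf-fill : ∀ {b} ps (cs : List (Fin n)) (src : Fin n → List (Fin q)) → length cs ≡ length ps →
  All (_≤ b) ps → (∀ i → b ≤ length (src i)) → partsOf (fill ps cs src) ≡ ps
partsOf-fill [] [] src _ _ _ = refl
partsOf-fill (p ∷ ps) (i ∷ cs) src |cs|≡ (p≤b ∷ ps≤b) b≤src =
  cong₂ _∷_ (length-take-≤ p (src i) (≤-trans p≤b (b≤src i))) (partsOf-fill ps cs src (suc-injective |cs|≡) ps≤b b≤src)

Unique-fill : ∀ ps (cs : List (Fin n)) (src : Fin n → List (Fin q)) → (∀ i → Unique (src i)) →
  All (Unique ∘ proj₂) (fill ps cs src)
Unique-fill (p ∷ ps) (i ∷ cs) src src! = Unique.take⁺ p (src! i) ∷ Unique-fill ps cs src src!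
Unique-fill [] _ _ _ = []
Unique-fill (_ ∷ _) [] _ _ = []

∈-edgeOf-fill⁻ : ∀ ps (cs : List (Fin n)) (src : Fin n → List (Fin q)) {v} → v ∈ edgeOf (fill ps cs src) →
  cls v ∈ cs × proj₂ v ∈ src (cls v)
∈-edgeOf-fill⁻ (p ∷ ps) (i ∷ cs) src v∈ with ∈-++⁻ (blockVertices (i , take p (src i))) v∈
... | inj₁ v∈b with l , l∈ , refl ← ∈-map⁻ (i ,_) v∈b = here refl , ∈-take p l∈
... | inj₂ v∈rest with v∈cs , v∈src ← ∈-edgeOf-fill⁻ ps cs src v∈rest = there v∈cs , v∈src

fill-meets : ∀ ps (cs : List (Fin n)) (src : Fin n → List (Fin q)) → length cs ≡ length ps → All (1 ≤_) ps →
  (∀ i → 1 ≤ length (src i)) → ∀ {h} → h ∈ cs → ∃ λ l → l ∈ src h × (h , l) ∈ edgeOf (fill ps cs src)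
fill-meets (p ∷ ps) (i ∷ cs) src _ (s≤s _ ∷ _) nonempty (here refl) with src i | nonempty i
... | l ∷ _ | _ = l , here refl , here refl
fill-meets (p ∷ ps) (i ∷ cs) src |cs|≡ (_ ∷ 1≤ps) nonempty (there h∈)
  with l , l∈ , hl∈ ← fill-meets ps cs src (suc-injective |cs|≡) 1≤ps nonempty h∈ =
  l , l∈ , ∈-++⁺ʳ (blockVertices (i , take p (src i))) hl∈

-- Monochromatic or rainbow subsets

constant-∈-map-take : ∀ (g : A → B) {x} k {L} → All (λ l → g l ≡ x) L → 1 ≤ length L → x ∈ map g (take (suc k) L)
constant-∈-map-take g k (gl≡x ∷ _) _ = here (sym gl≡x)

IsMonochromatic : (A → B) → List A → Set
IsMonochromatic g L = ∃ λ x → All (λ l → g l ≡ x) L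

IsRainbow : (A → B) → List A → Set
IsRainbow g L = Unique (map g L)

count-filter-≤ : ∀ (g : A → Fin m) {ℓ} {P : Pred A ℓ} (P? : Decidable P) (ls : List A) (z : Fin m) →
  count g (filter P? ls) z ≤ count g ls z
count-filter-≤ g P? ls z = Sublist.length-mono-≤ (Sublist.filter⁺ colour? colour? (λ { refl gl≡z → gl≡z }) (Sublist.filter-⊆ P? ls))
  where
  colour? = λ l → g l ≟ z

module _ (g : A → Fin m) where
  open import Data.List.Membership.DecPropositional (_≟_ {m}) using (_∈?_)

  representatives : List A → List A
  representatives [] = []
  representatives (l ∷ ls) with g l ∈? map g (representatives ls)
  ... | yes _ = representatives ls
  ... | no _ = l ∷ representatives ls

  IsRainbow-representatives : ∀ ls → IsRainbow g (representatives ls)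
  IsRainbow-representatives [] = []
  IsRainbow-representatives (l ∷ ls) with g l ∈? map g (representatives ls)
  ... | yes _ = IsRainbow-representatives ls
  ... | no gl∉ = All.tabulate (λ z∈ gl≡z → gl∉ (subst (_∈ _) (sym gl≡z) z∈)) ∷ IsRainbow-representatives ls

  representatives-cover : ∀ ls → map g ls ⊆ map g (representatives ls)
  representatives-cover (l ∷ ls) z∈ with g l ∈? map g (representatives ls) | z∈
  ... | yes gl∈ | here refl = gl∈
  ... | no _ | here refl = here refl
  ... | yes _ | there z∈′ = representatives-cover ls z∈′
  ... | no _ | there z∈′ = there (representatives-cover ls z∈′)

  length≤width*colours : ∀ b (S : List (Fin m)) (ls : List A) → map g ls ⊆ S → (∀ {z} → z ∈ S → count g ls z ≤ b) →
    length ls ≤ b * length S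
  length≤width*colours b [] [] _ _ = z≤n
  length≤width*colours b [] (l ∷ ls) ls⊆[] with () ← ls⊆[] (here refl)
  length≤width*colours b (s ∷ S) ls ls⊆ count≤b = begin
    length ls                    ≡⟨ length-filter-∁ (λ l → g l ≟ s) ls ⟨
    count g ls s + length others ≤⟨ +-mono-≤ (count≤b (here refl)) (length≤width*colours b S others others⊆S others-count≤b) ⟩
    b + b * length S             ≡⟨ *-suc b (length S) ⟨
    b * length (s ∷ S)           ∎
    where
    open ≤-Reasoning
    others = filter (λ l → ¬? (g l ≟ s)) ls
    others⊆S : map g others ⊆ S
    others⊆S z∈ with l , l∈ , refl ← ∈-map⁻ g z∈ with l∈ls , gl≢s ← ∈-filter⁻ (λ l → ¬? (g l ≟ s)) {xs = ls} l∈
      with ls⊆ (∈-map⁺ g l∈ls)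
    ... | here gl≡s = ⊥-elim (gl≢s gl≡s)
    ... | there gl∈S = gl∈S
    others-count≤b : ∀ {z} → z ∈ S → count g others z ≤ b
    others-count≤b {z} z∈ = ≤-trans (count-filter-≤ g (λ l → ¬? (g l ≟ s)) ls z) (count≤b (there z∈))

monochromatic-or-rainbow : ∀ {q} (g : Fin q → Fin m) s t → (s ∸ 1) * (t ∸ 1) < q →
  ∃ λ L → Unique L × ((length L ≡ s × IsMonochromatic g L) ⊎ (length L ≡ t × IsRainbow g L))
monochromatic-or-rainbow {q = q} g s t small with t ≤? length (representatives g (allFin q))
... | yes t≤ = take t R , Unique.map⁻ R-take! , inj₂ (length-take-≤ t R t≤ , R-take!)
  where
  R = representatives g (allFin q)
  R-take! : IsRainbow g (take t R)
  R-take! = Unique-map-take g t (IsRainbow-representatives g (allFin q))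
... | no t≰ with any? (λ z → s ≤? count g (allFin q) z) (map g (representatives g (allFin q)))
...   | yes big = take s F , Unique.take⁺ s (Unique.filter⁺ (λ l → g l ≟ z) (Unique.allFin⁺ q)) ,
                  inj₁ (length-take-≤ s F s≤ , z , All.tabulate λ l∈ → proj₂ (∈-filter⁻ (λ l → g l ≟ z) {xs = allFin q} (∈-take s l∈)))
  where
  z = proj₁ (Any.satisfied big)
  s≤ = proj₂ (Any.satisfied big)
  F = filter (λ l → g l ≟ z) (allFin q)
...   | no none = ⊥-elim (<⇒≱ small q≤)
  where
  S = map g (representatives g (allFin q))
  q≤ : q ≤ (s ∸ 1) * (t ∸ 1)
  q≤ = begin
    q                  ≡⟨ length-tabulate (λ l → l) ⟨
    length (allFin q)  ≤⟨ length≤width*colours g (s ∸ 1) S (allFin q) (representatives-cover g (allFin q))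
                            (λ z∈ → <⇒≤pred (≰⇒> (All.lookup (¬Any⇒All¬ S none) z∈))) ⟩
    (s ∸ 1) * length S ≤⟨ *-monoʳ-≤ (s ∸ 1) (≤-trans (≤-reflexive (length-map g (representatives g (allFin q)))) (<⇒≤pred (≰⇒> t≰))) ⟩
    (s ∸ 1) * (t ∸ 1)  ∎
    where open ≤-Reasoning

-- Partitions

length≤sum : {xs : List ℕ} → All (1 ≤_) xs → length xs ≤ sum xs
length≤sum [] = z≤n
length≤sum (1≤x ∷ 1≤xs) = +-mono-≤ 1≤x (length≤sum 1≤xs)

All-≤-sum : (xs : List ℕ) → All (_≤ sum xs) xs
All-≤-sum [] = []
All-≤-sum (x ∷ xs) = m≤m+n x (sum xs) ∷ All.map (λ y≤ → ≤-trans y≤ (m≤n+m (sum xs) x)) (All-≤-sum xs)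

all-one⇒replicate : {xs : List ℕ} → All (1 ≤_) xs → All (_≤ 1) xs → xs ≡ replicate (length xs) 1
all-one⇒replicate [] [] = refl
all-one⇒replicate (s≤s z≤n ∷ 1≤xs) (s≤s z≤n ∷ xs≤1) = cong (1 ∷_) (all-one⇒replicate 1≤xs xs≤1)

sum-replicate-1 : ∀ k → sum (replicate k 1) ≡ k
sum-replicate-1 zero = refl
sum-replicate-1 (suc k) = cong suc (sum-replicate-1 k)

partition-parts≤ : ∀ {r π} → IsPartition r π → All (_≤ r) π
partition-parts≤ {π = π} (_ , _ , sum≡r) = subst (λ s → All (_≤ s) π) sum≡r (All-≤-sum π)

partition-length≤ : ∀ {r π} → IsPartition r π → length π ≤ r
partition-length≤ (1≤π , _ , sum≡r) = ≤-trans (length≤sum 1≤π) (≤-reflexive sum≡r)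

non-monochromatic-shape : ∀ {r π} → IsPartition r π → 2 ≤ r → π ≢ Mono r → ∃₂ λ s₁ s₂ → ∃ λ rest → π ≡ s₁ ∷ s₂ ∷ rest
non-monochromatic-shape {π = []} (_ , _ , refl) 2≤r _ = ⊥-elim (<⇒≱ 2≤r z≤n)
non-monochromatic-shape {π = x ∷ []} (_ , _ , x+0≡r) _ π≢M = ⊥-elim (π≢M (cong (_∷ []) (trans (sym (+-identityʳ x)) x+0≡r)))
non-monochromatic-shape {π = s₁ ∷ s₂ ∷ rest} _ _ _ = s₁ , s₂ , rest , refl

non-rainbow-shape : ∀ {r π} → IsPartition r π → π ≢ Rainbow r →
  ∃₂ λ p rest → π ≡ suc (suc p) ∷ rest × suc (suc p) + length rest ≤ r
non-rainbow-shape {π = []} (_ , _ , refl) π≢R = ⊥-elim (π≢R refl)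
non-rainbow-shape {π = suc (suc p) ∷ rest} ((_ ∷ 1≤rest) , _ , sum≡r) _ =
  p , rest , refl , subst (suc (suc p) + length rest ≤_) sum≡r (+-monoʳ-≤ (suc (suc p)) (length≤sum 1≤rest))
non-rainbow-shape {r} {π = 1 ∷ rest} (1≤π , 1≥π , sum≡r) π≢R = ⊥-elim (π≢R (trans all-ones (cong (λ k → replicate k 1) length≡r)))
  where
  all-ones : 1 ∷ rest ≡ replicate (length (1 ∷ rest)) 1
  all-ones = all-one⇒replicate 1≤π (Linked⇒All (λ x≥y y≥z → ≤-trans y≥z x≥y) ≤-refl 1≥π)
  length≡r : length (1 ∷ rest) ≡ r
  length≡r = trans (sym (trans (cong sum all-ones) (sum-replicate-1 (length (1 ∷ rest))))) sum≡r
non-rainbow-shape {π = 0 ∷ _} ((() ∷ _) , _) _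

partition-↭⇒≡ : ∀ {r r′ π π′} → IsPartition r π → IsPartition r′ π′ → π ↭ π′ → π ≡ π′
partition-↭⇒≡ (_ , π↘ , _) (_ , π′↘ , _) π↭π′ =
  Pointwise-≡⇒≡ (Sorted.↗↭↗⇒≋ (Flip.totalOrder ≤-totalOrder) π↘ π′↘ (↭⇒↭ₛ π↭π′))

-- Extremal lengths, up to double negation

¬¬-least : ∀ {ℓ} (P : ℕ → Set ℓ) {n} → P n → ¬ ¬ (∃ λ m → P m × ∀ k → P k → m ≤ k)
¬¬-least P {n} = <-rec (λ n → P n → ¬ ¬ Least) step n
  where
  Least = ∃ λ m → P m × ∀ k → P k → m ≤ k
  step : ∀ n → WfRec _<_ (λ n → P n → ¬ ¬ Least) n → P n → ¬ ¬ Least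
  step n below Pn ¬least = ¬least (n , Pn , n≤)
    where
    n≤ : ∀ k → P k → n ≤ k
    n≤ k Pk with n ≤? k
    ... | yes n≤k = n≤k
    ... | no n≰k = ⊥-elim (below (≰⇒> n≰k) Pk ¬least)

¬¬-greatest : ∀ {ℓ} (P : ℕ → Set ℓ) b → (∀ k → P k → k ≤ b) → ∀ {n} → P n →
  ¬ ¬ (∃ λ m → P m × ∀ k → P k → k ≤ m)
¬¬-greatest P b bounded {n} Pn = <-rec Above step (b ∸ n) n refl Pn
  where
  Greatest = ∃ λ m → P m × ∀ k → P k → k ≤ m
  Above : ℕ → Set _
  Above d = ∀ n → b ∸ n ≡ d → P n → ¬ ¬ Greatest
  step : ∀ d → WfRec _<_ Above d → Above d
  step d below n refl Pn ¬greatest = ¬greatest (n , Pn , ≤n)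
    where
    ≤n : ∀ k → P k → k ≤ n
    ≤n k Pk with k ≤? n
    ... | yes k≤n = k≤n
    ... | no k≰n = ⊥-elim (below (∸-monoʳ-< (≰⇒> k≰n) (bounded k Pk)) k refl Pk ¬greatest)

-- Q-colourings are constant on classes

record IsClassColouring {n q m : ℕ} (c : Vtx n q → Fin m) : Set where
  field
    colour : Fin n → Fin m
    colour-cls : ∀ v → c v ≡ colour (cls v)
    colour-injective : ∀ {i j} → colour i ≡ colour j → i ≡ j

module ColouringStructure
  {n r q m : ℕ} (Q : PSet) (2≤r : 2 ≤ r) (q-large : (r ∸ 1) * (r ∸ 1) < q) (n-large : r + r ≤ n)
  (Q-partitions : ∀ π → Q π → IsPartition r π) (M∉Q : ¬ Q (Mono r)) (R∉Q : ¬ Q (Rainbow r))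
  (l₀ : Fin q) (c : Vtx n q → Fin m) (c-colouring : IsQCol n r q Q Q c) where

  open import Data.List.Membership.DecPropositional (_≟_ {m}) using (_∈?_)

  colourIn : Fin n → Fin q → Fin m
  colourIn j l = c (j , l)

  private
    chosen : ∀ j → ∃ λ L → Unique L × ((length L ≡ r × IsMonochromatic (colourIn j) L) ⊎ (length L ≡ r × IsRainbow (colourIn j) L))
    chosen j = monochromatic-or-rainbow (colourIn j) r r q-large

  sample : Fin n → List (Fin q)
  sample j = proj₁ (chosen j)

  Unique-sample : ∀ j → Unique (sample j)
  Unique-sample j = proj₁ (proj₂ (chosen j))

  length-sample : ∀ j → length (sample j) ≡ r
  length-sample j = [ proj₁ , proj₁ ]′ (proj₂ (proj₂ (chosen j)))

  r≤length-sample : ∀ j → r ≤ length (sample j)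
  r≤length-sample j = ≤-reflexive (sym (length-sample j))

  sample-kind : ∀ j → IsMonochromatic (colourIn j) (sample j) ⊎ IsRainbow (colourIn j) (sample j)
  sample-kind j = Sum.map proj₂ proj₂ (proj₂ (proj₂ (chosen j)))

  -- l₀ only supplies a value for rainbow classes, which are ruled out in the end.
  kindColour : ∀ {j} → IsMonochromatic (colourIn j) (sample j) ⊎ IsRainbow (colourIn j) (sample j) → Fin m
  kindColour (inj₁ (x , _)) = x
  kindColour {j} (inj₂ _) = colourIn j l₀

  classColour : Fin n → Fin m
  classColour j = kindColour (sample-kind j)

  Heavy : Fin n → Set
  Heavy j = All (λ l → colourIn j l ≡ classColour j) (sample j)

  heavy? : Decidable Heavy
  heavy? j = All.all? (λ l → colourIn j l ≟ classColour j) (sample j)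

  ¬Heavy⇒IsRainbow : ∀ {j} → ¬ Heavy j → IsRainbow (colourIn j) (sample j)
  ¬Heavy⇒IsRainbow {j} = from-kind (sample-kind j)
    where
    from-kind : (k : IsMonochromatic (colourIn j) (sample j) ⊎ IsRainbow (colourIn j) (sample j)) →
      ¬ All (λ l → colourIn j l ≡ kindColour k) (sample j) → IsRainbow (colourIn j) (sample j)
    from-kind (inj₁ (_ , monochromatic)) ¬heavy = ⊥-elim (¬heavy monochromatic)
    from-kind (inj₂ rainbow) _ = rainbow

  heavyClasses rainbowClasses : List (Fin n)
  heavyClasses = filter heavy? (allFin n)
  rainbowClasses = filter (¬? ∘ heavy?) (allFin n)

  length-heavy+rainbow : length heavyClasses + length rainbowClasses ≡ n
  length-heavy+rainbow = trans (length-filter-∁ heavy? (allFin n)) (length-tabulate (λ j → j))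

  Unique-heavyClasses : Unique heavyClasses
  Unique-heavyClasses = Unique.filter⁺ heavy? (Unique.allFin⁺ n)

  Unique-rainbowClasses : Unique rainbowClasses
  Unique-rainbowClasses = Unique.filter⁺ (¬? ∘ heavy?) (Unique.allFin⁺ n)

  ∈-heavyClasses⁻ : ∀ {j} → j ∈ heavyClasses → Heavy j
  ∈-heavyClasses⁻ j∈ = proj₂ (∈-filter⁻ heavy? {xs = allFin n} j∈)

  ∈-rainbowClasses⁻ : ∀ {j} → j ∈ rainbowClasses → IsRainbow (colourIn j) (sample j)
  ∈-rainbowClasses⁻ j∈ = ¬Heavy⇒IsRainbow (proj₂ (∈-filter⁻ (¬? ∘ heavy?) {xs = allFin n} j∈))

  pattern-length : ∀ {K} → IsEdge n r q Q K → ∃ λ π → Q π × length (profile c K) ≡ length π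
  pattern-length e with π , Qπ , pattern↭π ← c-colouring _ e = π , Qπ , ↭-length pattern↭π

  sampleEdge-isEdge : ∀ {π} → Q π → (cs : List (Fin n)) → Unique cs → length cs ≡ length π →
    IsEdge n r q Q (edgeOf (fill π cs sample))
  sampleEdge-isEdge {π} Qπ cs cs! |cs|≡ =
    edgeOf-isEdge (fill π cs sample) (Q-partitions π Qπ) Qπ
      (partsOf-fill π cs sample |cs|≡ (partition-parts≤ (Q-partitions π Qπ)) r≤length-sample)
      (subst Unique (sym (classesOf-fill π cs sample |cs|≡)) cs!) (Unique-fill π cs sample Unique-sample)

  classColours⊆colours-fill : ∀ π cs → All (1 ≤_) π → length cs ≡ length π → (∀ {h} → h ∈ cs → Heavy h) →
    map classColour cs ⊆ map c (edgeOf (fill π cs sample))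
  classColours⊆colours-fill π cs 1≤π |cs|≡ cs-heavy z∈
    with h , h∈ , refl ← ∈-map⁻ classColour z∈
    with l , l∈ , hl∈ ← fill-meets π cs sample |cs|≡ 1≤π (λ j → ≤-trans (≤-trans (s≤s z≤n) 2≤r) (r≤length-sample j)) h∈ =
    subst (_∈ _) (All.lookup (cs-heavy h∈) l∈) (∈-map⁺ c hl∈)

  colours-fill⊆classColours : ∀ π cs → (∀ {h} → h ∈ cs → Heavy h) → map c (edgeOf (fill π cs sample)) ⊆ map classColour cs
  colours-fill⊆classColours π cs cs-heavy z∈
    with v , v∈ , refl ← ∈-map⁻ c z∈
    with cls∈ , l∈ ← ∈-edgeOf-fill⁻ π cs sample v∈ =
    subst (_∈ _) (sym (All.lookup (cs-heavy cls∈) l∈)) (∈-map⁺ classColour cls∈)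

  greedyBlock : Fin n → List (Fin m) → ℕ → List (Fin q)
  greedyBlock k U p = avoiding (λ l → colourIn k l ∈? U) p (sample k)

  greedy : List ℕ → List (Fin n) → List (Fin m) → List (Block n q)
  greedy (p ∷ ps) (k ∷ ks) U = (k , greedyBlock k U p) ∷ greedy ps ks (U ++ map (colourIn k) (greedyBlock k U p))
  greedy _ _ _ = []

  AllRainbow : List (Fin n) → Set
  AllRainbow ks = ∀ {k} → k ∈ ks → IsRainbow (colourIn k) (sample k)

  length-greedyBlock : ∀ {k} U p → IsRainbow (colourIn k) (sample k) → p + length U ≤ r → length (greedyBlock k U p) ≡ p
  length-greedyBlock {k} U p rainbow p+|U|≤r =
    length-avoiding used? p (length U) (sample k) few-used (subst (p + length U ≤_) (sym (length-sample k)) p+|U|≤r)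
    where
    used? = λ l → colourIn k l ∈? U
    few-used : length (filter used? (sample k)) ≤ length U
    few-used = subst (_≤ length U) (length-map (colourIn k) (filter used? (sample k)))
      (Unique⇒length≤ (Unique-map-filter (colourIn k) used? rainbow)
        λ z∈ → let l , l∈ , z≡ = ∈-map⁻ (colourIn k) z∈ in subst (_∈ U) (sym z≡) (proj₂ (∈-filter⁻ used? {xs = sample k} l∈)))

  partsOf-greedy : ∀ ps ks U → length ks ≡ length ps → AllRainbow ks → length U + sum ps ≤ r → partsOf (greedy ps ks U) ≡ ps
  partsOf-greedy [] [] U _ _ _ = refl
  partsOf-greedy (p ∷ ps) (k ∷ ks) U |ks|≡ rainbow |U|+sum≤r = cong₂ _∷_ |block|≡p
    (partsOf-greedy ps ks (U ++ map (colourIn k) block) (suc-injective |ks|≡) (rainbow ∘ there) (begin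
      length (U ++ map (colourIn k) block) + sum ps ≡⟨ cong (_+ sum ps) (trans (length-++ U) (cong (length U +_) (trans (length-map _ block) |block|≡p))) ⟩
      length U + p + sum ps                  ≡⟨ +-assoc (length U) p (sum ps) ⟩
      length U + (p + sum ps)                ≤⟨ |U|+sum≤r ⟩
      r                                      ∎))
    where
    open ≤-Reasoning
    block = greedyBlock k U p
    |block|≡p : length block ≡ p
    |block|≡p = length-greedyBlock U p (rainbow (here refl))
      (≤-trans (≤-reflexive (+-comm p (length U))) (≤-trans (+-monoʳ-≤ (length U) (m≤m+n p (sum ps))) |U|+sum≤r))

  classesOf-greedy : ∀ ps ks U → length ks ≡ length ps → classesOf (greedy ps ks U) ≡ ks
  classesOf-greedy [] [] U _ = refl
  classesOf-greedy (p ∷ ps) (k ∷ ks) U |ks|≡ = cong (k ∷_) (classesOf-greedy ps ks _ (suc-injective |ks|≡))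

  Unique-greedy : ∀ ps ks U → All (Unique ∘ proj₂) (greedy ps ks U)
  Unique-greedy (p ∷ ps) (k ∷ ks) U =
    Unique-avoiding (λ l → colourIn k l ∈? U) p (Unique-sample k) ∷ Unique-greedy ps ks _
  Unique-greedy [] _ _ = []
  Unique-greedy (_ ∷ _) [] _ = []

  distinct-colours-greedy : ∀ ps ks U → AllRainbow ks → Unique U → Unique (U ++ map c (edgeOf (greedy ps ks U)))
  distinct-colours-greedy [] _ U _ U! = subst Unique (sym (++-identityʳ U)) U!
  distinct-colours-greedy (_ ∷ _) [] U _ U! = subst Unique (sym (++-identityʳ U)) U!
  distinct-colours-greedy (p ∷ ps) (k ∷ ks) U rainbow U! =
    subst Unique (rearrange (edgeOf (greedy ps ks U′)))
      (distinct-colours-greedy ps ks U′ (rainbow ∘ there) (Unique.++⁺ U! block-rainbow disjoint))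
    where
    used? = λ l → colourIn k l ∈? U
    block = greedyBlock k U p
    U′ = U ++ map (colourIn k) block
    block-rainbow : Unique (map (colourIn k) block)
    block-rainbow = Unique-map-take (colourIn k) p (Unique-map-filter (colourIn k) (¬? ∘ used?) (rainbow (here refl)))
    disjoint : ∀ {z} → ¬ (z ∈ U × z ∈ map (colourIn k) block)
    disjoint (z∈U , z∈block) with l , l∈ , refl ← ∈-map⁻ (colourIn k) z∈block = proj₂ (∈-avoiding⁻ used? p (sample k) l∈) z∈U
    rearrange : ∀ E → U′ ++ map c E ≡ U ++ map c (blockVertices (k , block) ++ E)
    rearrange E = trans (++-assoc U (map (colourIn k) block) (map c E))
      (cong (U ++_) (sym (trans (map-++ c (blockVertices (k , block)) E) (cong (_++ map c E) (sym (map-∘ block))))))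

  classColour-∈-take : ∀ {j} k → Heavy j → classColour j ∈ map (colourIn j) (take (suc k) (sample j))
  classColour-∈-take {j} k heavy =
    constant-∈-map-take (colourIn j) k heavy (≤-trans (≤-trans (s≤s z≤n) 2≤r) (r≤length-sample j))

  module Extremal
    (p : ℕ) (rest : List ℕ) (Q-longest : Q (suc (suc p) ∷ rest))
    (longest : ∀ π → Q π → length π ≤ suc (length rest))
    (s₁ s₂ : ℕ) (shortest-rest : List ℕ) (Q-shortest : Q (s₁ ∷ s₂ ∷ shortest-rest))
    (shortest : ∀ π → Q π → suc (suc (length shortest-rest)) ≤ length π)
    where

    T : ℕ
    T = suc (length rest)

    longest-partition : IsPartition r (suc (suc p) ∷ rest)
    longest-partition = Q-partitions _ Q-longest

    head+length≤r : suc (suc p) + length rest ≤ r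
    head+length≤r with (_ ∷ 1≤rest) , _ , sum≡r ← longest-partition =
      subst (_ ≤_) sum≡r (+-monoʳ-≤ (suc (suc p)) (length≤sum 1≤rest))

    T<r : T < r
    T<r = ≤-trans (s≤s (s≤s (m≤n+m (length rest) p))) head+length≤r

    pattern≤T : ∀ {K} → IsEdge n r q Q K → length (profile c K) ≤ T
    pattern≤T e with π , Qπ , |pattern|≡ ← pattern-length e = subst (_≤ T) (sym |pattern|≡) (longest π Qπ)

    pattern≥t : ∀ {K} → IsEdge n r q Q K → suc (suc (length shortest-rest)) ≤ length (profile c K)
    pattern≥t e with π , Qπ , |pattern|≡ ← pattern-length e = subst (_ ≤_) (sym |pattern|≡) (shortest π Qπ)

    rainbowClasses-few : length rainbowClasses < T
    rainbowClasses-few = ≰⇒> too-many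
      where
      too-many : T ≤ length rainbowClasses → ⊥
      too-many T≤ = <⇒≱ T<r (≤-trans r≤pattern (pattern≤T e))
        where
        π = suc (suc p) ∷ rest
        cs = take T rainbowClasses
        |cs|≡ : length cs ≡ length π
        |cs|≡ = length-take-≤ T rainbowClasses T≤
        cs-rainbow : AllRainbow cs
        cs-rainbow k∈ = ∈-rainbowClasses⁻ (∈-take T k∈)
        bs = greedy π cs []
        parts≡ : partsOf bs ≡ π
        parts≡ = partsOf-greedy π cs [] |cs|≡ cs-rainbow (≤-reflexive (proj₂ (proj₂ longest-partition)))
        e : IsEdge n r q Q (edgeOf bs)
        e = edgeOf-isEdge bs longest-partition Q-longest parts≡
              (subst Unique (sym (classesOf-greedy π cs [] |cs|≡)) (Unique.take⁺ T Unique-rainbowClasses)) (Unique-greedy π cs [])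
        |colours|≡r : length (map c (edgeOf bs)) ≡ r
        |colours|≡r = trans (length-map c (edgeOf bs))
          (trans (length-edgeOf bs) (trans (cong sum parts≡) (proj₂ (proj₂ longest-partition))))
        r≤pattern : r ≤ length (profile c (edgeOf bs))
        r≤pattern = subst (_≤ length (profile c (edgeOf bs))) |colours|≡r
          (≤-length-profile c (edgeOf bs) (distinct-colours-greedy π cs [] cs-rainbow []) (λ z∈ → z∈))

    heavyClasses-many : r + 2 ≤ length heavyClasses
    heavyClasses-many = +-cancelʳ-≤ (length rainbowClasses) (r + 2) (length heavyClasses) (begin
      r + 2 + length rainbowClasses          ≡⟨ +-assoc r 2 (length rainbowClasses) ⟩
      r + (2 + length rainbowClasses)        ≤⟨ +-monoʳ-≤ r (≤-trans (s≤s rainbowClasses-few) T<r) ⟩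
      r + r                                  ≤⟨ n-large ⟩
      n                                      ≡⟨ length-heavy+rainbow ⟨
      length heavyClasses + length rainbowClasses ∎)
      where open ≤-Reasoning

    no-shared-heavy-colour : ∀ {i j} → Heavy i → Heavy j → i ≢ j → classColour i ≢ classColour j
    no-shared-heavy-colour {i} {j} heavy-i heavy-j i≢j ci≡cj = 1+n≰n (≤-trans (pattern≥t e) pattern≤)
      where
      π = s₁ ∷ s₂ ∷ shortest-rest
      k = length shortest-rest
      pair? = λ h → (h ≟ i) ⊎-dec (h ≟ j)
      others = avoiding pair? k heavyClasses
      few-pair : length (filter pair? heavyClasses) ≤ 2
      few-pair = Unique⇒length≤ {ys = i ∷ j ∷ []} (Unique.filter⁺ pair? Unique-heavyClasses)
        λ h∈ → [ (λ { refl → here refl }) , (λ { refl → there (here refl) }) ]′ (proj₂ (∈-filter⁻ pair? {xs = heavyClasses} h∈))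
      |others|≡k : length others ≡ k
      |others|≡k = length-avoiding pair? k 2 heavyClasses few-pair
        (≤-trans (≤-trans (≤-reflexive (+-comm k 2)) (partition-length≤ (Q-partitions π Q-shortest)))
                 (≤-trans (m≤m+n r 2) heavyClasses-many))
      not-pair : ∀ {h} → h ∈ others → ¬ (h ≡ i ⊎ h ≡ j)
      not-pair h∈ = proj₂ (∈-avoiding⁻ pair? k heavyClasses h∈)
      cs = i ∷ j ∷ others
      cs! : Unique cs
      cs! = (i≢j ∷ All.tabulate (λ h∈ i≡h → not-pair h∈ (inj₁ (sym i≡h))))
          ∷ All.tabulate (λ h∈ j≡h → not-pair h∈ (inj₂ (sym j≡h)))
          ∷ Unique-avoiding pair? k Unique-heavyClasses
      cs-heavy : ∀ {h} → h ∈ cs → Heavy h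
      cs-heavy (here refl) = heavy-i
      cs-heavy (there (here refl)) = heavy-j
      cs-heavy (there (there h∈)) = ∈-heavyClasses⁻ (proj₁ (∈-avoiding⁻ pair? k heavyClasses h∈))
      K = edgeOf (fill π cs sample)
      e : IsEdge n r q Q K
      e = sampleEdge-isEdge Q-shortest cs cs! (cong (λ x → suc (suc x)) |others|≡k)
      colours⊆ : map c K ⊆ classColour i ∷ map classColour others
      colours⊆ z∈ with colours-fill⊆classColours π cs cs-heavy z∈
      ... | here refl = here refl
      ... | there (here refl) = here (sym ci≡cj)
      ... | there (there z∈others) = there z∈others
      pattern≤ : length (profile c K) ≤ suc k
      pattern≤ = ≤-trans (length-profile-≤ c K colours⊆) (≤-reflexive (cong suc (trans (length-map classColour others) |others|≡k)))

    heavy-colours-distinct : ∀ {i j} → Heavy i → Heavy j → classColour i ≡ classColour j → i ≡ j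
    heavy-colours-distinct {i} {j} heavy-i heavy-j ci≡cj with i ≟ j
    ... | yes i≡j = i≡j
    ... | no i≢j = ⊥-elim (no-shared-heavy-colour heavy-i heavy-j i≢j ci≡cj)

    freshHeavy : List (Fin m) → ℕ → List (Fin n)
    freshHeavy taken k = avoiding (λ h → classColour h ∈? taken) k heavyClasses

    module _ {taken : List (Fin m)} {k : ℕ} where

      private
        clash? = λ h → classColour h ∈? taken

      ∈-freshHeavy⁻ : ∀ {h} → h ∈ freshHeavy taken k → Heavy h × ¬ (classColour h ∈ taken)
      ∈-freshHeavy⁻ h∈ = Product.map₁ ∈-heavyClasses⁻ (∈-avoiding⁻ clash? k heavyClasses h∈)

      Unique-freshHeavy : Unique (freshHeavy taken k)
      Unique-freshHeavy = Unique-avoiding clash? k Unique-heavyClasses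

      IsRainbow-freshHeavy : IsRainbow classColour (freshHeavy taken k)
      IsRainbow-freshHeavy = Unique-map-injectiveOn classColour Unique-freshHeavy
        λ x∈ y∈ → heavy-colours-distinct (proj₁ (∈-freshHeavy⁻ x∈)) (proj₁ (∈-freshHeavy⁻ y∈))

      length-freshHeavy : k + length taken ≤ length heavyClasses → length (freshHeavy taken k) ≡ k
      length-freshHeavy room = length-avoiding clash? k (length taken) heavyClasses few-clashes room
        where
        clashing = filter clash? heavyClasses
        injective : ∀ {x y} → x ∈ clashing → y ∈ clashing → classColour x ≡ classColour y → x ≡ y
        injective x∈ y∈ = heavy-colours-distinct (∈-heavyClasses⁻ (proj₁ (∈-filter⁻ clash? {xs = heavyClasses} x∈)))
                                                 (∈-heavyClasses⁻ (proj₁ (∈-filter⁻ clash? {xs = heavyClasses} y∈)))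
        clashing⊆ : map classColour clashing ⊆ taken
        clashing⊆ z∈ with h , h∈ , refl ← ∈-map⁻ classColour z∈ = proj₂ (∈-filter⁻ clash? {xs = heavyClasses} h∈)
        few-clashes : length clashing ≤ length taken
        few-clashes = subst (_≤ length taken) (length-map classColour clashing)
          (Unique⇒length≤ (Unique-map-injectiveOn classColour (Unique.filter⁺ clash? Unique-heavyClasses) injective) clashing⊆)

    room-for-rest : ∀ {taken : List (Fin m)} → length taken ≡ suc (suc (suc p)) → length rest + length taken ≤ length heavyClasses
    room-for-rest {taken} |taken|≡ = begin
      length rest + length taken        ≡⟨ cong (length rest +_) |taken|≡ ⟩
      length rest + suc (suc (suc p))   ≡⟨ +-comm (length rest) _ ⟩
      suc (suc (suc p) + length rest)   ≤⟨ s≤s head+length≤r ⟩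
      suc r                             ≤⟨ ≤-trans (n≤1+n (suc r)) (≤-reflexive (+-comm 2 r)) ⟩
      r + 2                             ≤⟨ heavyClasses-many ⟩
      length heavyClasses               ∎
      where open ≤-Reasoning

    no-rich-block : ∀ j (block : List (Fin q)) (C : List (Fin m)) → Unique block → length block ≡ suc (suc p) →
      Unique C → 2 ≤ length C → C ⊆ map (colourIn j) block → ⊥
    no-rich-block j block C block! |block|≡ C! 2≤|C| C⊆ = 1+n≰n (≤-trans T<pattern (pattern≤T e))
      where
      k = length rest
      taken = classColour j ∷ map (colourIn j) block
      others = freshHeavy taken k
      |others|≡k : length others ≡ k
      |others|≡k = length-freshHeavy (room-for-rest {taken} (cong suc (trans (length-map (colourIn j) block) |block|≡)))
      fresh : ∀ {h} → h ∈ others → ¬ (classColour h ∈ taken)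
      fresh h∈ = proj₂ (∈-freshHeavy⁻ h∈)
      bs = (j , block) ∷ fill rest others sample
      classes! : Unique (classesOf bs)
      classes! = subst Unique (cong (j ∷_) (sym (classesOf-fill rest others sample |others|≡k)))
        (All.tabulate (λ h∈ j≡h → fresh h∈ (here (cong classColour (sym j≡h)))) ∷ Unique-freshHeavy)
      e : IsEdge n r q Q (edgeOf bs)
      e = edgeOf-isEdge bs longest-partition Q-longest
            (cong₂ _∷_ |block|≡ (partsOf-fill rest others sample |others|≡k (All.tail (partition-parts≤ longest-partition)) r≤length-sample))
            classes! (block! ∷ Unique-fill rest others sample Unique-sample)
      distinct = C ++ map classColour others
      distinct! : Unique distinct
      distinct! = Unique.++⁺ C! IsRainbow-freshHeavy λ (z∈C , z∈others) →
        let h , h∈ , z≡ = ∈-map⁻ classColour z∈others in fresh h∈ (there (subst (_∈ _) z≡ (C⊆ z∈C)))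
      distinct⊆ : distinct ⊆ map c (edgeOf bs)
      distinct⊆ z∈ = subst (_ ∈_) (sym (map-++ c (blockVertices (j , block)) _))
        (Subset.++⁺ (λ z∈C → subst (_ ∈_) (map-∘ block) (C⊆ z∈C))
                    (classColours⊆colours-fill rest others (All.tail (proj₁ longest-partition)) |others|≡k (proj₁ ∘ ∈-freshHeavy⁻))
                    z∈)
      T<pattern : suc T ≤ length (profile c (edgeOf bs))
      T<pattern = ≤-trans
        (≤-trans (+-monoˡ-≤ k 2≤|C|) (≤-reflexive (sym (trans (length-++ C) (cong (length C +_) (trans (length-map classColour others) |others|≡k))))))
        (≤-length-profile c (edgeOf bs) distinct! distinct⊆)

    all-heavy : ∀ j → Heavy j
    all-heavy j with heavy? j
    ... | yes heavy = heavy
    ... | no ¬heavy = ⊥-elim (no-rich-block j block (map (colourIn j) block) (Unique.take⁺ _ (Unique-sample j)) |block|≡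
                               (Unique-map-take (colourIn j) _ (¬Heavy⇒IsRainbow ¬heavy))
                               (≤-trans (s≤s (s≤s z≤n)) (≤-reflexive (sym (trans (length-map (colourIn j) block) |block|≡))))
                               (λ z∈ → z∈))
      where
      block = take (suc (suc p)) (sample j)
      |block|≡ : length block ≡ suc (suc p)
      |block|≡ = length-take-≤ _ (sample j) (≤-trans (≤-trans (m≤m+n _ (length rest)) head+length≤r) (r≤length-sample j))

    constant-on-classes : ∀ j l → colourIn j l ≡ classColour j
    constant-on-classes j l with colourIn j l ≟ classColour j
    ... | yes coloured = coloured
    ... | no miscoloured = ⊥-elim (no-rich-block j block (colourIn j l ∷ classColour j ∷ []) block! |block|≡
                                    ((miscoloured ∷ []) ∷ [] ∷ []) (s≤s (s≤s z≤n)) C⊆)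
      where
      block = l ∷ take (suc p) (sample j)
      |block|≡ : length block ≡ suc (suc p)
      |block|≡ = cong suc (length-take-≤ _ (sample j)
        (≤-trans (≤-trans (n≤1+n (suc p)) (≤-trans (m≤m+n _ (length rest)) head+length≤r)) (r≤length-sample j)))
      block! : Unique block
      block! = All.tabulate (λ l′∈ l≡l′ → miscoloured (subst (λ x → colourIn j x ≡ classColour j) (sym l≡l′)
                                                          (All.lookup (all-heavy j) (∈-take (suc p) l′∈))))
             ∷ Unique.take⁺ (suc p) (Unique-sample j)
      C⊆ : colourIn j l ∷ classColour j ∷ [] ⊆ map (colourIn j) block
      C⊆ (here refl) = here refl
      C⊆ (there (here refl)) = there (classColour-∈-take p (all-heavy j))

    classColour-injective : ∀ {i j} → classColour i ≡ classColour j → i ≡ j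
    classColour-injective = heavy-colours-distinct (all-heavy _) (all-heavy _)

  Longest Shortest : Set
  Longest = ∃₂ λ p rest → Q (suc (suc p) ∷ rest) × (∀ π → Q π → length π ≤ suc (length rest))
  Shortest = ∃₂ λ s₁ s₂ → ∃ λ rest → Q (s₁ ∷ s₂ ∷ rest) × (∀ π → Q π → suc (suc (length rest)) ≤ length π)

  HasLength : ℕ → Set
  HasLength k = ∃ λ π → Q π × length π ≡ k

  longest-of : ∀ {π} → Q π → (∀ π′ → Q π′ → length π′ ≤ length π) → Longest
  longest-of {π} Qπ greatest with p , rest , refl , _ ← non-rainbow-shape (Q-partitions π Qπ) (λ π≡R → R∉Q (subst Q π≡R Qπ)) =
    p , rest , Qπ , greatest

  shortest-of : ∀ {π} → Q π → (∀ π′ → Q π′ → length π ≤ length π′) → Shortest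
  shortest-of {π} Qπ least with s₁ , s₂ , rest , refl ← non-monochromatic-shape (Q-partitions π Qπ) 2≤r (λ π≡M → M∉Q (subst Q π≡M Qπ)) =
    s₁ , s₂ , rest , Qπ , least

  ¬¬-extremal : ∃ Q → (Longest → Shortest → ⊥) → ⊥
  ¬¬-extremal (π₀ , Qπ₀) absurd =
    ¬¬-greatest HasLength r (λ { _ (π , Qπ , refl) → partition-length≤ (Q-partitions π Qπ) }) (π₀ , Qπ₀ , refl)
      λ { (_ , (π , Qπ , refl) , greatest) →
    ¬¬-least HasLength (π₀ , Qπ₀ , refl)
      λ { (_ , (π′ , Qπ′ , refl) , least) →
    absurd (longest-of Qπ λ σ Qσ → greatest _ (σ , Qσ , refl)) (shortest-of Qπ′ λ σ Qσ → least _ (σ , Qσ , refl)) } }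

  constant-on-classes : ∃ Q → ∀ j l → colourIn j l ≡ classColour j
  constant-on-classes Q≢∅ j l = decidable-stable (colourIn j l ≟ classColour j) λ miscoloured →
    ¬¬-extremal Q≢∅ λ { (p , rest , QL , longest) (s₁ , s₂ , rest′ , QS , shortest) →
      miscoloured (Extremal.constant-on-classes p rest QL longest s₁ s₂ rest′ QS shortest j l) }

  classColour-injective : ∃ Q → ∀ {i j} → classColour i ≡ classColour j → i ≡ j
  classColour-injective Q≢∅ {i} {j} same = decidable-stable (i ≟ j) λ i≢j →
    ¬¬-extremal Q≢∅ λ { (p , rest , QL , longest) (s₁ , s₂ , rest′ , QS , shortest) →
      i≢j (Extremal.classColour-injective p rest QL longest s₁ s₂ rest′ QS shortest same) }

  isClassColouring : ∃ Q → IsClassColouring c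
  isClassColouring Q≢∅ = record
    { colour = classColour
    ; colour-cls = λ v → constant-on-classes Q≢∅ (cls v) (proj₂ v)
    ; colour-injective = classColour-injective Q≢∅
    }

Q-colouring⇒IsClassColouring : ∀ {n r q m} (Q : PSet) → 2 ≤ r → (r ∸ 1) * (r ∸ 1) < q → r + r ≤ n →
  (∀ π → Q π → IsPartition r π) → ¬ Q (Mono r) → ¬ Q (Rainbow r) → ∃ Q →
  (c : Vtx n q → Fin m) → IsQCol n r q Q Q c → IsClassColouring c
Q-colouring⇒IsClassColouring {q = suc _} Q 2≤r q-large n-large Q-partitions M∉Q R∉Q Q≢∅ c c-colouring =
  ColouringStructure.isClassColouring Q 2≤r q-large n-large Q-partitions M∉Q R∉Q zero c c-colouring Q≢∅

-- Colourings constant on classes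

cls-isKQCol : ∀ {n r q} (Q : PSet) → Fin q → IsKQCol n r q Q Q n cls
cls-isKQCol Q l₀ = (λ _ (_ , _ , pattern∈Q) → pattern∈Q) , λ i → (i , l₀) , λ { refl → refl }

IsQCol-∖ : ∀ {n r q m} {Σ′ Q : PSet} {π} {c : Vtx n q → Fin m} → IsQCol n r q Σ′ (Q ∖[ π ]) c → IsQCol n r q Σ′ Q c
IsQCol-∖ avoids-π K e with π′ , (Qπ′ , _) , pattern↭π′ ← avoids-π K e = π′ , Qπ′ , pattern↭π′

length-filter-≟ : ∀ {n} (i : Fin n) {xs : List (Fin n)} → Unique xs → i ∈ xs → length (filter (_≟ i) xs) ≡ 1
length-filter-≟ i {x ∷ xs} (x∉ ∷ xs!) i∈ with x ≟ i | i∈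
... | yes refl | _ = cong suc (cong length (filter-none (_≟ i) (All.map (λ i≢y y≡i → i≢y (sym y≡i)) x∉)))
... | no x≢i | here i≡x = ⊥-elim (x≢i (sym i≡x))
... | no _ | there i∈xs = length-filter-≟ i xs! i∈xs

length-filter-cls : ∀ {n q} (i : Fin n) (xs : List (Fin n)) (ys : List (Fin q)) →
  length (filter (λ v → cls v ≟ i) (cartesianProduct xs ys)) ≡ length (filter (_≟ i) xs) * length ys
length-filter-cls i [] ys = refl
length-filter-cls i (x ∷ xs) ys = begin
  length (filter in-i? (map (x ,_) ys ++ cartesianProduct xs ys))
    ≡⟨ cong length (filter-++ in-i? (map (x ,_) ys) (cartesianProduct xs ys)) ⟩
  length (filter in-i? (map (x ,_) ys) ++ filter in-i? (cartesianProduct xs ys))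
    ≡⟨ length-++ (filter in-i? (map (x ,_) ys)) ⟩
  length (filter in-i? (map (x ,_) ys)) + length (filter in-i? (cartesianProduct xs ys))
    ≡⟨ cong₂ _+_ (length-filter-∘ in-i? (x ,_) ys) (length-filter-cls i xs ys) ⟩
  length (filter (λ _ → x ≟ i) ys) + length (filter (_≟ i) xs) * length ys
    ≡⟨ split (x ≟ i) ⟩
  length (filter (_≟ i) (x ∷ xs)) * length ys ∎
  where
  open ≡-Reasoning
  in-i? = λ v → cls v ≟ i
  split : Dec (x ≡ i) → length (filter (λ _ → x ≟ i) ys) + length (filter (_≟ i) xs) * length ys
                        ≡ length (filter (_≟ i) (x ∷ xs)) * length ys
  split (yes x≡i) = trans (cong (λ zs → length zs + length (filter (_≟ i) xs) * length ys) (filter-all (λ _ → x ≟ i) {ys} (All.tabulate λ _ → x≡i)))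
                          (cong (λ zs → length zs * length ys) (sym (filter-accept (_≟ i) x≡i)))
  split (no x≢i) = trans (cong (λ zs → length zs + length (filter (_≟ i) xs) * length ys) (filter-none (λ _ → x ≟ i) {ys} (All.tabulate λ _ → x≢i)))
                         (cong (λ zs → length zs * length ys) (sym (filter-reject (_≟ i) x≢i)))

module _ {n q m : ℕ} {c : Vtx n q → Fin m} (c-class : IsClassColouring c) where
  open IsClassColouring c-class

  same-colour⇔same-class : ∀ u v → (c u ≡ c v) ⇔ (cls u ≡ cls v)
  same-colour⇔same-class u v = mk⇔
    (λ cu≡cv → colour-injective (trans (sym (colour-cls u)) (trans cu≡cv (colour-cls v))))
    (λ u≡v → trans (colour-cls u) (trans (cong colour u≡v) (sym (colour-cls v))))

  module _ (onto : Surjective _≡_ _≡_ c) where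

    representative : Fin m → Vtx n q
    representative b = proj₁ (onto b)

    colour-representative : ∀ b → c (representative b) ≡ b
    colour-representative b = proj₂ (onto b) refl

    colours≡classes : m ≡ n
    colours≡classes = sym (cantor-schröder-bernstein {f = colour} {g = cls ∘ representative} colour-injective
      λ {a} {b} same → begin
        a                           ≡⟨ colour-representative a ⟨
        c (representative a)        ≡⟨ colour-cls (representative a) ⟩
        colour (cls (representative a)) ≡⟨ cong colour same ⟩
        colour (cls (representative b)) ≡⟨ colour-cls (representative b) ⟨
        c (representative b)        ≡⟨ colour-representative b ⟩
        b                           ∎)
      where open ≡-Reasoning

    classSize≡q : ∀ b → classSize c b ≡ q
    classSize≡q b = begin
      length (filter (λ v → c v ≟ b) (allVtx n q))                 ≡⟨ cong length (filter-≐ (λ v → c v ≟ b) (λ v → cls v ≟ i) (in-b⇒in-i , in-i⇒in-b) (allVtx n q)) ⟩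
      length (filter (λ v → cls v ≟ i) (allVtx n q))               ≡⟨ length-filter-cls i (allFin n) (allFin q) ⟩
      length (filter (_≟ i) (allFin n)) * length (allFin q)        ≡⟨ cong₂ _*_ (length-filter-≟ i (Unique.allFin⁺ n) (∈-allFin i)) (length-tabulate (λ l → l)) ⟩
      1 * q                                                        ≡⟨ *-identityˡ q ⟩
      q                                                            ∎
      where
      open ≡-Reasoning
      i = cls (representative b)
      in-b⇒in-i : ∀ {v} → c v ≡ b → cls v ≡ i
      in-b⇒in-i {v} cv≡b = Equivalence.to (same-colour⇔same-class v _) (trans cv≡b (sym (colour-representative b)))
      in-i⇒in-b : ∀ {v} → cls v ≡ i → c v ≡ b
      in-i⇒in-b {v} v≡i = trans (Equivalence.from (same-colour⇔same-class v _) v≡i) (colour-representative b)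

  realises : ∀ {r} {Q : PSet} {π} → Q π → IsPartition r π → length π ≤ n → r ≤ q →
    ∃ λ K → IsEdge n r q Q K × profile c K ↭ π
  realises {r} {Q} {π} Qπ π-partition |π|≤n r≤q =
    edgeOf bs , edgeOf-isEdge bs π-partition Qπ parts≡ classes! (Unique-fill π cs full (λ _ → Unique.allFin⁺ q)) ,
    subst (profile c (edgeOf bs) ↭_) parts≡
      (profile-edgeOf c colour colour-injective colour-cls bs classes! (subst (All (1 ≤_)) (sym parts≡) (proj₁ π-partition)))
    where
    cs = take (length π) (allFin n)
    full : Fin n → List (Fin q)
    full _ = allFin q
    |cs|≡ : length cs ≡ length π
    |cs|≡ = length-take-≤ (length π) (allFin n) (subst (length π ≤_) (sym (length-tabulate (λ i → i))) |π|≤n)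
    bs = fill π cs full
    parts≡ : partsOf bs ≡ π
    parts≡ = partsOf-fill π cs full |cs|≡ (partition-parts≤ π-partition) (λ _ → subst (r ≤_) (sym (length-tabulate (λ l → l))) r≤q)
    classes! : Unique (classesOf bs)
    classes! = subst Unique (sym (classesOf-fill π cs full |cs|≡)) (Unique.take⁺ (length π) (Unique.allFin⁺ n))

  pattern-unavoidable : ∀ {r} {Q : PSet} {π} → (∀ σ → Q σ → IsPartition r σ) → Q π → length π ≤ n → r ≤ q →
    ¬ IsQCol n r q Q (Q ∖[ π ]) c
  pattern-unavoidable Q-partitions Qπ |π|≤n r≤q avoids-π
    with K , K-edge , pattern↭π ← realises Qπ (Q-partitions _ Qπ) |π|≤n r≤q
    with π′ , (Qπ′ , π′≢π) , pattern↭π′ ← avoids-π K K-edge =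
    π′≢π (partition-↭⇒≡ (Q-partitions π′ Qπ′) (Q-partitions _ Qπ) (↭-trans (↭-sym pattern↭π′) pattern↭π))

n≤[n∸1]^2+1 : ∀ n → 2 ≤ n → n ≤ (n ∸ 1) ^ 2 + 1
n≤[n∸1]^2+1 (suc (suc k)) (s≤s (s≤s z≤n)) = ≤-trans (≤-reflexive (+-comm 1 (suc k))) (+-monoˡ-≤ 1 (m≤m*n (suc k) (suc k * 1)))

theorem2p1 : (r : ℕ) → 2 ≤ r → (Q : PSet) → (∀ p → Q p → IsPartition r p) →
    (∃[ π ] Q π) → ¬ Q (Mono r) → ¬ Q (Rainbow r) →
    ∃[ k ]
      ((∃[ c ] IsKQCol (2 * r) r ((r ∸ 1) ^ 2 + 1) Q Q k c)
      × (∀ j (c : Vtx (2 * r) ((r ∸ 1) ^ 2 + 1) → Fin j) →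
           IsKQCol (2 * r) r ((r ∸ 1) ^ 2 + 1) Q Q j c → j ≡ k)
      × (∀ (c c′ : Vtx (2 * r) ((r ∸ 1) ^ 2 + 1) → Fin k) →
           IsKQCol (2 * r) r ((r ∸ 1) ^ 2 + 1) Q Q k c →
           IsKQCol (2 * r) r ((r ∸ 1) ^ 2 + 1) Q Q k c′ →
           ∀ u v → (c u ≡ c v) ⇔ (c′ u ≡ c′ v))
      × (∀ (c : Vtx (2 * r) ((r ∸ 1) ^ 2 + 1) → Fin k) →
           IsKQCol (2 * r) r ((r ∸ 1) ^ 2 + 1) Q Q k c →
           ∀ a b → classSize c a ≡ classSize c b)
      × (∀ π → Q π → ∀ m (c : Vtx (2 * r) ((r ∸ 1) ^ 2 + 1) → Fin m) →
           ¬ IsQCol (2 * r) r ((r ∸ 1) ^ 2 + 1) Q (Q ∖[ π ]) c))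
theorem2p1 r 2≤r Q Q-partitions Q≢∅ M∉Q R∉Q =
  classes , (cls , cls-isKQCol Q (fromℕ< (≤-<-trans z≤n q-large)))
    , (λ _ c (c-colouring , onto) → colours≡classes (structure c c-colouring) onto)
    , (λ c c′ (c-colouring , _) (c′-colouring , _) u v →
         ⇔.trans (same-colour⇔same-class (structure c c-colouring) u v) (⇔.sym (same-colour⇔same-class (structure c′ c′-colouring) u v)))
    , (λ c (c-colouring , onto) a b → trans (classSize≡q (structure c c-colouring) onto a) (sym (classSize≡q (structure c c-colouring) onto b)))
    , minimal
  where
  classes = 2 * r
  size = (r ∸ 1) ^ 2 + 1
  q-large : (r ∸ 1) * (r ∸ 1) < size
  q-large = ≤-reflexive (trans (cong suc (cong ((r ∸ 1) *_) (sym (*-identityʳ (r ∸ 1))))) (+-comm 1 ((r ∸ 1) ^ 2)))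
  structure : ∀ {m} (c : Vtx classes size → Fin m) → IsQCol classes r size Q Q c → IsClassColouring c
  structure = Q-colouring⇒IsClassColouring Q 2≤r q-large (≤-reflexive (cong (r +_) (sym (+-identityʳ r)))) Q-partitions M∉Q R∉Q Q≢∅
  minimal : ∀ π → Q π → ∀ m (c : Vtx classes size → Fin m) → ¬ IsQCol classes r size Q (Q ∖[ π ]) c
  minimal π Qπ m c avoids-π =
    pattern-unavoidable (structure c (IsQCol-∖ {c = c} avoids-π)) Q-partitions Qπ
      (≤-trans (partition-length≤ (Q-partitions π Qπ)) (m≤m+n r (r + 0))) (n≤[n∸1]^2+1 r 2≤r) avoids-π
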